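{- Let $n \geq 2$, $V = \{0,\dotsc,n\}$, and let $P = (V,E)$ be the path with $E = \{\{i,i+1\} \mid i \in \{0,\dotsc,n-1\}\}$. Then $\Xi_P \subseteq \Theta^{\mathrm{Path}}_P \subseteq \Theta^1_P$.
   Context: Let $m = \binom{n+1}{2}$. Vectors $x \in \mathbb{R}^m$ have coordinates $x_{ij} = x_{ji}$ indexed by unordered pairs of distinct nodes; for an edge $e = \{i,j\}$ write $x_e = x_{ij}$. $P_{uv}$ is the subpath of $P$ from $u$ to $v$ and $\mathrm{dist}(u,v) = |u-v|$. $X_P$ is the set of all $x \in \{0,1\}^m$ such that for all $u,v$ with $\mathrm{dist}(u,v) \geq 2$: $x_{uv} \leq \sum_{e \in P_{uv}} x_e$ and $x_e \leq x_{uv}$ for every $e \in P_{uv}$; $\Xi_P = \operatorname{conv} X_P$. For $u,v$ with $\mathrm{dist}(u,v) \geq 2$, $\vec{u}(v)$ denotes the neighbor of $u$ on $P_{uv}$. $\Theta^1_P$ is the set of $x \in [0,1]^m$ such that for all ordered pairs $(u,v)$ with $\mathrm{dist}(u,v) \geq 2$: $x_{uv} \leq x_{u,\vec{u}(v)} + x_{\vec{u}(v),v}$ and $x_{\vec{u}(v),v} \leq x_{uv}$. $\Theta^{\mathrm{Path}}_P$ is the set of $x \in \mathbb{R}^m$ satisfying: $x_{0n} \leq 1$; $x_{in} \leq x_{i-1,n}$ for all $i \in \{1,\dotsc,n-1\}$; $x_{0i} \leq x_{0,i+1}$ for all $i \in \{1,\dotsc,n-1\}$; $x_{i-1,i+1}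 \leq x_{i-1,i} + x_{i,i+1}$ for all $i \in \{1,\dotsc,n-1\}$; and $x_{j,k} + x_{j+1,k-1} \leq x_{j+1,k} + x_{j,k-1}$ for all $j,k \in \{0,\dotsc,n\}$ with $j < k-2$.
   Formalization: The sets $\Xi_P$, $\Theta^{\mathrm{Path}}_P$ and $\Theta^1_P$ are taken in ℚ^m rather than ℝ^m, so the weights of the convex combinations forming $\Xi_P$ are rational too. -}

module Defs where

open import Data.Nat as ℕ using (ℕ; zero; suc; _∸_)
open import Data.Rational using (ℚ; 0ℚ; 1ℚ; _+_; _*_; _≤_)
open import Data.List using (List; []; _∷_)
open import Data.List.Relation.Unary.All using (All)
open import Data.Product using (_×_; _,_; ∃; proj₁; proj₂)
open import Data.Sum using (_⊎_)
open import Relation.Binary.PropositionalEquality using (_≡_)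

-- A vector x ∈ ℚ^m, m = (n+1 choose 2), is represented by a function
-- x : ℕ → ℕ → ℚ where x i j is the coordinate x_{ij} = x_{ji} for the
-- unordered pair {i,j}, read only for i < j ≤ n (other values are ignored
-- by every definition below).
Coords : Set
Coords = ℕ → ℕ → ℚ

pathSumFrom : Coords → ℕ → ℕ → ℚ
pathSumFrom x i zero    = 0ℚ
pathSumFrom x i (suc l) = x i (suc i) + pathSumFrom x (suc i) l

pathSum : Coords → ℕ → ℕ → ℚ
pathSum x i j = pathSumFrom x i (j ∸ i)

-- X_P : 0/1 vectors satisfying the path constraints (pairs with dist ≥ 2,
-- written with i < j, i + 2 ≤ j ≤ n; the constraints are symmetric in u,v)
X : ℕ → Coords → Set
X n x =
  (∀ i j → i ℕ.< j → j ℕ.≤ n → (x i j ≡ 0ℚ) ⊎ (x i j ≡ 1ℚ)) ×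
  (∀ i j → suc (suc i) ℕ.≤ j → j ℕ.≤ n →
     (x i j ≤ pathSum x i j) ×
     (∀ k → i ℕ.≤ k → k ℕ.< j → x k (suc k) ≤ x i j))

conv : ℕ → (Coords → Set) → Coords → Set
conv n S x = ∃ λ (c : List (ℚ × Coords)) →
  All (λ p → (0ℚ ≤ proj₁ p) × S (proj₂ p)) c ×
  (sumW c ≡ 1ℚ) ×
  (∀ i j → i ℕ.< j → j ℕ.≤ n → x i j ≡ comb c i j)
  where
  sumW : List (ℚ × Coords) → ℚ
  sumW [] = 0ℚ
  sumW ((l , _) ∷ c) = l + sumW c
  comb : List (ℚ × Coords) → ℕ → ℕ → ℚ
  comb [] i j = 0ℚ
  comb ((l , y) ∷ c) i j = l * y i j + comb c i j

Ξ : ℕ → Coords → Set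
Ξ n = conv n (X n)

-- Θ^1_P : x ∈ [0,1]^m with, for every ordered pair (u,v), dist ≥ 2.
-- For i < j (i + 2 ≤ j): the pair (i,j) has i's neighbour i+1, the pair
-- (j,i) has j's neighbour j-1.
Θ1 : ℕ → Coords → Set
Θ1 n x =
  (∀ i j → i ℕ.< j → j ℕ.≤ n → (0ℚ ≤ x i j) × (x i j ≤ 1ℚ)) ×
  (∀ i j → suc (suc i) ℕ.≤ j → j ℕ.≤ n →
     -- ordered pair (u,v) = (i,j), u→(v) = i+1
     (x i j ≤ x i (suc i) + x (suc i) j) × (x (suc i) j ≤ x i j) ×
     -- ordered pair (u,v) = (j,i), u→(v) = j-1
     (x i j ≤ x (j ∸ 1) j + x i (j ∸ 1)) × (x i (j ∸ 1) ≤ x i j))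

-- Θ^Path_P ; the index i ∈ {1,…,n-1} of the paper is written suc i here
-- (so i ranges over i + 2 ≤ n).
ΘPath : ℕ → Coords → Set
ΘPath n x =
  (x 0 n ≤ 1ℚ) ×
  (∀ i → suc (suc i) ℕ.≤ n →
     (x (suc i) n ≤ x i n) ×
     (x 0 (suc i) ≤ x 0 (suc (suc i))) ×
     (x i (suc (suc i)) ≤ x i (suc i) + x (suc i) (suc (suc i)))) ×
  (∀ j k → j ℕ.+ 3 ℕ.≤ k → k ℕ.≤ n →
     x j k + x (suc j) (k ∸ 1) ≤ x (suc j) k + x j (k ∸ 1))

-- A point y of X_P is the indicator of "P_uv contains a selected edge": y_uv = 1 exactly when some
-- edge of P_uv has value 1. Such a y is therefore monotone under inclusion of subpaths and satisfies
-- y_{P ∪ Q} ≤ y_P + y_Q for overlapping subpaths, which yields every inequality of Θ^Path; these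
-- inequalities are affine, so they pass to the convex hull Ξ_P.
-- Conversely, the supermodularity inequalities of Θ^Path say precisely that the gap x_ij - x_{i+1,j}
-- decreases in j and the gap x_{i,j+1} - x_ij increases in i. Comparing a gap with the extreme one
-- (j = n or i = 0, controlled by the monotonicity constraints, and j = i + 2 or i = j - 2, controlled
-- by the triangle constraints) gives the four inequalities of Θ^1; with x_0n ≤ 1 they also bound x.
module Submission where

open import Defs

module PathPolytopes where

  open import Data.Nat as ℕ using (ℕ; zero; suc; z≤n; s≤s; z<s; _≤′_; ≤′-refl; ≤′-step)
  import Data.Nat.Properties as ℕ
  open import Data.Rational using (ℚ; 0ℚ; 1ℚ; _+_; _-_; _*_; -_; _≤_; nonNegative)
  import Data.Rational.Properties as ℚ
  open import Data.Rational.Solver using (module +-*-Solver)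
  open import Data.List using (List; []; _∷_)
  open import Data.List.Relation.Unary.All using (All; []; _∷_)
  open import Data.Product using (_×_; _,_; ∃; proj₁; proj₂)
  open import Data.Sum using (_⊎_; inj₁; inj₂)
  open import Function using (flip)
  open import Level using (Level)
  open import Relation.Binary.Core using (Rel)
  open import Relation.Binary.Definitions using (Reflexive; Transitive)
  open import Relation.Binary.PropositionalEquality using (_≡_; refl; sym; trans; cong; cong₂)

  open ℚ.≤-Reasoning
  open +-*-Solver using (solve; _:=_; _:+_; _:*_; _:-_; :-_)

  p+q≤r+s⇒p-r≤s-q : ∀ p q r s → p + q ≤ r + s → p - r ≤ s - q
  p+q≤r+s⇒p-r≤s-q p q r s h = begin
    p - r                 ≡⟨ solve 3 (λ p q r → p :- r := (p :+ q) :+ (:- r :- q)) refl p q r ⟩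
    (p + q) + (- r - q)   ≤⟨ ℚ.+-monoˡ-≤ (- r - q) h ⟩
    (r + s) + (- r - q)   ≡⟨ solve 3 (λ q r s → (r :+ s) :+ (:- r :- q) := s :- q) refl q r s ⟩
    s - q                 ∎

  p+q≤r+s⇒p-s≤r-q : ∀ p q r s → p + q ≤ r + s → p - s ≤ r - q
  p+q≤r+s⇒p-s≤r-q p q r s h =
    p+q≤r+s⇒p-r≤s-q p q s r (ℚ.≤-trans h (ℚ.≤-reflexive (ℚ.+-comm r s)))

  p≤q+r⇒p-r≤q : ∀ {p} q r → p ≤ q + r → p - r ≤ q
  p≤q+r⇒p-r≤q {p} q r h = begin
    p - r         ≤⟨ ℚ.+-monoˡ-≤ (- r) h ⟩
    (q + r) - r   ≡⟨ solve 2 (λ q r → (q :+ r) :- r := q) refl q r ⟩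
    q             ∎

  p-r≤q⇒p≤q+r : ∀ {p q} r → p - r ≤ q → p ≤ q + r
  p-r≤q⇒p≤q+r {p} {q} r h = begin
    p             ≡⟨ solve 2 (λ p r → p := (p :- r) :+ r) refl p r ⟩
    (p - r) + r   ≤⟨ ℚ.+-monoˡ-≤ r h ⟩
    q + r         ∎

  p≤q⇒0≤q-p : ∀ {p q} → p ≤ q → 0ℚ ≤ q - p
  p≤q⇒0≤q-p {p} {q} h = begin
    0ℚ      ≡⟨ sym (ℚ.+-inverseʳ p) ⟩
    p - p   ≤⟨ ℚ.+-monoˡ-≤ (- p) h ⟩
    q - p   ∎

  0≤q-p⇒p≤q : ∀ {p q} → 0ℚ ≤ q - p → p ≤ q
  0≤q-p⇒p≤q {p} {q} h = begin
    p              ≡⟨ sym (ℚ.+-identityˡ p) ⟩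
    0ℚ + p         ≤⟨ ℚ.+-monoˡ-≤ p h ⟩
    (q - p) + p    ≡⟨ solve 2 (λ p q → (q :- p) :+ p := q) refl p q ⟩
    q              ∎

  p≤q+r⇒r≤p⇒0≤q : ∀ {p} q r → p ≤ q + r → r ≤ p → 0ℚ ≤ q
  p≤q+r⇒r≤p⇒0≤q q r p≤q+r r≤p = ℚ.≤-trans (p≤q⇒0≤q-p r≤p) (p≤q+r⇒p-r≤q q r p≤q+r)

  p≤p+q : ∀ {p q} → 0ℚ ≤ q → p ≤ p + q
  p≤p+q {p} {q} h = begin
    p        ≡⟨ sym (ℚ.+-identityʳ p) ⟩
    p + 0ℚ   ≤⟨ ℚ.+-monoʳ-≤ p h ⟩
    p + q    ∎

  p≤q+p : ∀ {p q} → 0ℚ ≤ q → p ≤ q + p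
  p≤q+p {p} {q} h = ℚ.≤-trans (p≤p+q h) (ℚ.≤-reflexive (ℚ.+-comm p q))

  module _ {a ℓ : Level} {A : Set a} where

    StepwiseOn : Rel A ℓ → (ℕ → A) → ℕ → ℕ → Set ℓ
    StepwiseOn _≲_ f lo hi = ∀ {k} → lo ℕ.≤ k → k ℕ.< hi → f k ≲ f (suc k)

    MonotoneOn : Rel A ℓ → (ℕ → A) → ℕ → ℕ → Set ℓ
    MonotoneOn _≲_ f lo hi = ∀ {i j} → lo ℕ.≤ i → i ℕ.≤ j → j ℕ.≤ hi → f i ≲ f j

    stepwise⇒monotone : ∀ {_≲_ : Rel A ℓ} → Reflexive _≲_ → Transitive _≲_ →
                        ∀ f {lo hi} → StepwiseOn _≲_ f lo hi → MonotoneOn _≲_ f lo hi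
    stepwise⇒monotone {_≲_} ≲-refl ≲-trans f {lo} {hi} step {i} lo≤i i≤j = go (ℕ.≤⇒≤′ i≤j)
      where
      go : ∀ {j} → i ≤′ j → j ℕ.≤ hi → f i ≲ f j
      go ≤′-refl          _    = ≲-refl
      go (≤′-step i≤′j) j<hi =
        ≲-trans (go i≤′j (ℕ.<⇒≤ j<hi)) (step (ℕ.≤-trans lo≤i (ℕ.≤′⇒≤ i≤′j)) j<hi)

  ℚ-stepwise⇒monotone : ∀ f {lo hi} → StepwiseOn _≤_ f lo hi → MonotoneOn _≤_ f lo hi
  ℚ-stepwise⇒monotone = stepwise⇒monotone {_≲_ = _≤_} ℚ.≤-refl ℚ.≤-trans

  ℚ-stepwise⇒antitone : ∀ f {lo hi} → StepwiseOn (flip _≤_) f lo hi → MonotoneOn (flip _≤_) f lo hi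
  ℚ-stepwise⇒antitone = stepwise⇒monotone {_≲_ = flip _≤_} ℚ.≤-refl (λ q≤p r≤q → ℚ.≤-trans r≤q q≤p)

  average : List (ℚ × Coords) → (Coords → ℚ) → ℚ
  average []            F = 0ℚ
  average ((w , y) ∷ c) F = w * F y + average c F

  average-unique : ∀ F (g : List (ℚ × Coords) → ℚ) → g [] ≡ 0ℚ →
                   (∀ w y c → g ((w , y) ∷ c) ≡ w * F y + g c) → ∀ c → g c ≡ average c F
  average-unique F g g[]≡0 g-step []            = g[]≡0
  average-unique F g g[]≡0 g-step ((w , y) ∷ c) =
    trans (g-step w y c) (cong (w * F y +_) (average-unique F g g[]≡0 g-step c))

  NonnegWeightsIn : (Coords → Set) → List (ℚ × Coords) → Set
  NonnegWeightsIn S = All (λ p → (0ℚ ≤ proj₁ p) × S (proj₂ p))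

  ConvexAverage : ℕ → (Coords → Set) → Coords → Set
  ConvexAverage n S x =
    ∃ λ c → NonnegWeightsIn S c × (average c (λ _ → 1ℚ) ≡ 1ℚ) ×
            (∀ {i j} → i ℕ.< j → j ℕ.≤ n → x i j ≡ average c (λ y → y i j))

  -- conv's weight sum and combination are local to its where block and cannot be named; their defining
  -- equations, which hold by refl, identify them with average.
  conv-by-equations : ∀ {n S x} (sumW : List (ℚ × Coords) → ℚ) (comb : List (ℚ × Coords) → ℕ → ℕ → ℚ) →
    sumW [] ≡ 0ℚ → (∀ w y c → sumW ((w , y) ∷ c) ≡ w + sumW c) →
    (∀ i j → comb [] i j ≡ 0ℚ) → (∀ w y c i j → comb ((w , y) ∷ c) i j ≡ w * y i j + comb c i j) →
    (∃ λ c → NonnegWeightsIn S c × (sumW c ≡ 1ℚ) × (∀ i j → i ℕ.< j → j ℕ.≤ n → x i j ≡ comb c i j)) →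
    ConvexAverage n S x
  conv-by-equations sumW comb sumW-[] sumW-∷ comb-[] comb-∷ (c , c∈S , sumW≡1 , x≡comb) =
    c , c∈S , trans (sym (average-unique _ sumW sumW-[] weight-∷ c)) sumW≡1 ,
    λ {i} {j} i<j j≤n → trans (x≡comb i j i<j j≤n)
                              (average-unique _ (λ c → comb c i j) (comb-[] i j) (λ w y c → comb-∷ w y c i j) c)
    where
    weight-∷ : ∀ w y c → sumW ((w , y) ∷ c) ≡ w * 1ℚ + sumW c
    weight-∷ w y c = trans (sumW-∷ w y c) (cong (_+ sumW c) (sym (ℚ.*-identityʳ w)))

  conv⇒average : ∀ {n S x} → conv n S x → ConvexAverage n S x
  conv⇒average = conv-by-equations _ _ refl (λ _ _ _ → refl) (λ _ _ → refl) (λ _ _ _ _ _ → refl)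

  average-+ : ∀ c (F G : Coords → ℚ) → average c (λ y → F y + G y) ≡ average c F + average c G
  average-+ []            F G = sym (ℚ.+-identityˡ 0ℚ)
  average-+ ((w , y) ∷ c) F G = begin-equality
    w * (F y + G y) + average c (λ y → F y + G y)   ≡⟨ cong (w * (F y + G y) +_) (average-+ c F G) ⟩
    w * (F y + G y) + (average c F + average c G)
      ≡⟨ solve 5 (λ w a b A B → w :* (a :+ b) :+ (A :+ B) := (w :* a :+ A) :+ (w :* b :+ B))
               refl w (F y) (G y) (average c F) (average c G) ⟩
    (w * F y + average c F) + (w * G y + average c G) ∎

  average-mono : ∀ {S : Coords → Set} {F G : Coords → ℚ} c → NonnegWeightsIn S c →
                 (∀ {y} → S y → F y ≤ G y) → average c F ≤ average c G
  average-mono []            []                   F≤G = ℚ.≤-refl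
  average-mono ((w , y) ∷ c) ((0≤w , y∈S) ∷ c∈S) F≤G =
    ℚ.+-mono-≤ (ℚ.*-monoˡ-≤-nonNeg w {{nonNegative 0≤w}} (F≤G y∈S)) (average-mono c c∈S F≤G)

  -- conv determines x only at the pairs i < j ≤ n, hence the bounds carried by coord.
  data AffineTerm (n : ℕ) : Set where
    one   : AffineTerm n
    coord : ∀ i j → i ℕ.< j → j ℕ.≤ n → AffineTerm n
    _⊕_   : AffineTerm n → AffineTerm n → AffineTerm n

  ⟦_⟧ : ∀ {n} → AffineTerm n → Coords → ℚ
  ⟦ one ⟧           x = 1ℚ
  ⟦ coord i j _ _ ⟧ x = x i j
  ⟦ s ⊕ t ⟧         x = ⟦ s ⟧ x + ⟦ t ⟧ x

  average-⟦⟧ : ∀ {n S x} (hull : ConvexAverage n S x) (t : AffineTerm n) → ⟦ t ⟧ x ≡ average (proj₁ hull) ⟦ t ⟧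
  average-⟦⟧ (_ , _ , weights≡1 , _) one                 = sym weights≡1
  average-⟦⟧ (_ , _ , _ , x≡average) (coord _ _ i<j j≤n) = x≡average i<j j≤n
  average-⟦⟧ hull                    (s ⊕ t)             =
    trans (cong₂ _+_ (average-⟦⟧ hull s) (average-⟦⟧ hull t)) (sym (average-+ (proj₁ hull) ⟦ s ⟧ ⟦ t ⟧))

  conv-preserves-≤ : ∀ {n S x} → conv n S x → (s t : AffineTerm n) →
                     (∀ {y} → S y → ⟦ s ⟧ y ≤ ⟦ t ⟧ y) → ⟦ s ⟧ x ≤ ⟦ t ⟧ x
  conv-preserves-≤ {x = x} x∈conv s t s≤t with conv⇒average x∈conv
  ... | hull@(c , c∈S , _ , _) = begin
    ⟦ s ⟧ x        ≡⟨ average-⟦⟧ hull s ⟩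
    average c ⟦ s ⟧ ≤⟨ average-mono c c∈S s≤t ⟩
    average c ⟦ t ⟧ ≡⟨ sym (average-⟦⟧ hull t) ⟩
    ⟦ t ⟧ x        ∎

  EdgesNonpos : Coords → ℕ → ℕ → Set
  EdgesNonpos y i j = ∀ k → i ℕ.≤ k → k ℕ.< j → y k (suc k) ≤ 0ℚ

  pathSumFrom-nonpos : ∀ (y : Coords) i l → EdgesNonpos y i (i ℕ.+ l) → pathSumFrom y i l ≤ 0ℚ
  pathSumFrom-nonpos y i zero    _         = ℚ.≤-refl
  pathSumFrom-nonpos y i (suc l) edges≤0 = begin
    y i (suc i) + pathSumFrom y (suc i) l   ≤⟨ ℚ.+-mono-≤ (edges≤0 i ℕ.≤-refl (ℕ.m<m+n i z<s)) rest≤0 ⟩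
    0ℚ + 0ℚ                                 ≡⟨ ℚ.+-identityˡ 0ℚ ⟩
    0ℚ                                      ∎
    where
    rest≤0 : pathSumFrom y (suc i) l ≤ 0ℚ
    rest≤0 = pathSumFrom-nonpos y (suc i) l λ k i+1≤k k<i+1+l →
      edges≤0 k (ℕ.≤-trans (ℕ.n≤1+n i) i+1≤k) (ℕ.<-≤-trans k<i+1+l (ℕ.≤-reflexive (sym (ℕ.+-suc i l))))

  pathSum-nonpos : ∀ (y : Coords) {i j} → i ℕ.≤ j → EdgesNonpos y i j → pathSum y i j ≤ 0ℚ
  pathSum-nonpos y {i} {j} i≤j edges≤0 = pathSumFrom-nonpos y i (j ℕ.∸ i) λ k i≤k k<i+[j-i] →
    edges≤0 k i≤k (ℕ.<-≤-trans k<i+[j-i] (ℕ.≤-reflexive (ℕ.m+[n∸m]≡n i≤j)))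

  -- The last family of constraints of Θ^Path, with k - 1 renamed k to avoid truncated subtraction.
  Supermodular : ℕ → Coords → Set
  Supermodular n x = ∀ {j k} → suc (suc j) ℕ.≤ k → k ℕ.< n →
                     x j (suc k) + x (suc j) k ≤ x (suc j) (suc k) + x j k

  module XProperties {n : ℕ} {y : Coords} (y∈X : X n y) where

    X-binary : ∀ {i j} → i ℕ.< j → j ℕ.≤ n → (y i j ≡ 0ℚ) ⊎ (y i j ≡ 1ℚ)
    X-binary = proj₁ y∈X _ _

    X-nonneg : ∀ {i j} → i ℕ.< j → j ℕ.≤ n → 0ℚ ≤ y i j
    X-nonneg i<j j≤n with X-binary i<j j≤n
    ... | inj₁ y≡0 = ℚ.≤-reflexive (sym y≡0)
    ... | inj₂ y≡1 = ℚ.≤-trans (ℚ.nonNegative⁻¹ 1ℚ) (ℚ.≤-reflexive (sym y≡1))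

    X-≤1 : ∀ {i j} → i ℕ.< j → j ℕ.≤ n → y i j ≤ 1ℚ
    X-≤1 i<j j≤n with X-binary i<j j≤n
    ... | inj₁ y≡0 = ℚ.≤-trans (ℚ.≤-reflexive y≡0) (ℚ.nonNegative⁻¹ 1ℚ)
    ... | inj₂ y≡1 = ℚ.≤-reflexive y≡1

    X-edge≤ : ∀ {i k j} → i ℕ.≤ k → k ℕ.< j → j ℕ.≤ n → y k (suc k) ≤ y i j
    X-edge≤ {i} {k} {j} i≤k k<j j≤n with ℕ.m≤n⇒m<n∨m≡n (ℕ.≤-<-trans i≤k k<j)
    ... | inj₁ i+2≤j = proj₂ (proj₂ y∈X i j i+2≤j j≤n) k i≤k k<j
    ... | inj₂ refl with ℕ.≤-antisym i≤k (ℕ.≤-pred k<j)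
    ...   | refl = ℚ.≤-refl

    X-nonpos : ∀ {i j} → i ℕ.< j → j ℕ.≤ n → EdgesNonpos y i j → y i j ≤ 0ℚ
    X-nonpos {i} {j} i<j j≤n edges≤0 with ℕ.m≤n⇒m<n∨m≡n i<j
    ... | inj₁ i+2≤j = ℚ.≤-trans (proj₁ (proj₂ y∈X i j i+2≤j j≤n)) (pathSum-nonpos y (ℕ.<⇒≤ i<j) edges≤0)
    ... | inj₂ refl  = edges≤0 i ℕ.≤-refl ℕ.≤-refl

    X-mono : ∀ {i j i′ j′} → i′ ℕ.≤ i → i ℕ.< j → j ℕ.≤ j′ → j′ ℕ.≤ n → y i j ≤ y i′ j′
    X-mono {i} {j} i′≤i i<j j≤j′ j′≤n with X-binary (ℕ.≤-<-trans i′≤i (ℕ.<-≤-trans i<j j≤j′)) j′≤n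
    ... | inj₂ y′≡1 = ℚ.≤-trans (X-≤1 i<j (ℕ.≤-trans j≤j′ j′≤n)) (ℚ.≤-reflexive (sym y′≡1))
    ... | inj₁ y′≡0 = ℚ.≤-trans (X-nonpos i<j (ℕ.≤-trans j≤j′ j′≤n) edges≤0) (ℚ.≤-reflexive (sym y′≡0))
      where
      edges≤0 : EdgesNonpos y i j
      edges≤0 k i≤k k<j =
        ℚ.≤-trans (X-edge≤ (ℕ.≤-trans i′≤i i≤k) (ℕ.<-≤-trans k<j j≤j′) j′≤n) (ℚ.≤-reflexive y′≡0)

    X-union≤ : ∀ {j k} → j ℕ.< k → k ℕ.< n → y j (suc k) ≤ y (suc j) (suc k) + y j k
    X-union≤ {j} {k} j<k k<n with X-binary (s≤s j<k) k<n | X-binary j<k (ℕ.<⇒≤ k<n)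
    ... | inj₂ right≡1 | _ = begin
      y j (suc k)                 ≤⟨ X-≤1 (ℕ.m<n⇒m<1+n j<k) k<n ⟩
      1ℚ                          ≡⟨ sym right≡1 ⟩
      y (suc j) (suc k)           ≤⟨ p≤p+q (X-nonneg j<k (ℕ.<⇒≤ k<n)) ⟩
      y (suc j) (suc k) + y j k   ∎
    ... | _ | inj₂ left≡1 = begin
      y j (suc k)                 ≤⟨ X-≤1 (ℕ.m<n⇒m<1+n j<k) k<n ⟩
      1ℚ                          ≡⟨ sym left≡1 ⟩
      y j k                       ≤⟨ p≤q+p (X-nonneg (s≤s j<k) k<n) ⟩
      y (suc j) (suc k) + y j k   ∎
    ... | inj₁ right≡0 | inj₁ left≡0 = begin
      y j (suc k)                 ≤⟨ X-nonpos (ℕ.m<n⇒m<1+n j<k) k<n edges≤0 ⟩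
      0ℚ                          ≡⟨ sym (ℚ.+-identityˡ 0ℚ) ⟩
      0ℚ + 0ℚ                     ≡⟨ sym (cong₂ _+_ right≡0 left≡0) ⟩
      y (suc j) (suc k) + y j k   ∎
      where
      edges≤0 : EdgesNonpos y j (suc k)
      edges≤0 l j≤l l<k+1 with ℕ.<-≤-connex l k
      ... | inj₁ l<k = ℚ.≤-trans (X-edge≤ j≤l l<k (ℕ.<⇒≤ k<n)) (ℚ.≤-reflexive left≡0)
      ... | inj₂ k≤l = ℚ.≤-trans (X-edge≤ (ℕ.<-≤-trans j<k k≤l) l<k+1 k<n) (ℚ.≤-reflexive right≡0)

    X-triangle : ∀ {i} → suc (suc i) ℕ.≤ n → y i (suc (suc i)) ≤ y i (suc i) + y (suc i) (suc (suc i))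
    X-triangle {i} i+2≤n = ℚ.≤-trans (X-union≤ (ℕ.n<1+n i) i+2≤n)
                                     (ℚ.≤-reflexive (ℚ.+-comm (y (suc i) (suc (suc i))) (y i (suc i))))

    X-supermodular : Supermodular n y
    X-supermodular {j} {k} j+2≤k k<n with X-binary j+2≤k (ℕ.<⇒≤ k<n)
    ... | inj₁ inner≡0 = begin
      y j (suc k) + y (suc j) k   ≡⟨ cong (y j (suc k) +_) inner≡0 ⟩
      y j (suc k) + 0ℚ            ≡⟨ ℚ.+-identityʳ (y j (suc k)) ⟩
      y j (suc k)                 ≤⟨ X-union≤ (ℕ.<-trans (ℕ.n<1+n j) j+2≤k) k<n ⟩
      y (suc j) (suc k) + y j k   ∎
    ... | inj₂ inner≡1 = ℚ.+-mono-≤ outer≤right inner≤left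
      where
      outer≤right : y j (suc k) ≤ y (suc j) (suc k)
      outer≤right = begin
        y j (suc k)       ≤⟨ X-≤1 (ℕ.<-trans (ℕ.n<1+n j) (ℕ.m<n⇒m<1+n j+2≤k)) k<n ⟩
        1ℚ                ≡⟨ sym inner≡1 ⟩
        y (suc j) k       ≤⟨ X-mono ℕ.≤-refl j+2≤k (ℕ.n≤1+n k) k<n ⟩
        y (suc j) (suc k) ∎
      inner≤left : y (suc j) k ≤ y j k
      inner≤left = X-mono (ℕ.n≤1+n j) j+2≤k ℕ.≤-refl (ℕ.<⇒≤ k<n)

  unshift-supermodular : ∀ {n x} → Supermodular n x →
    ∀ j k → j ℕ.+ 3 ℕ.≤ k → k ℕ.≤ n → x j k + x (suc j) (k ℕ.∸ 1) ≤ x (suc j) k + x j (k ℕ.∸ 1)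
  unshift-supermodular supermodular j k j+3≤k k≤n with ℕ.≤-trans (ℕ.≤-reflexive (ℕ.+-comm 3 j)) j+3≤k
  ... | s≤s j+2≤k-1 = supermodular j+2≤k-1 k≤n

  Ξ⊆ΘPath : ∀ {n x} → 2 ℕ.≤ n → Ξ n x → ΘPath n x
  Ξ⊆ΘPath {n} {x} n≥2 x∈Ξ =
    lift (coord 0 n 0<n ℕ.≤-refl) one (λ y∈X → X-≤1 y∈X 0<n ℕ.≤-refl) ,
    (λ i i+2≤n →
      lift (coord (suc i) n i+2≤n ℕ.≤-refl) (coord i n (ℕ.<⇒≤ i+2≤n) ℕ.≤-refl)
           (λ y∈X → X-mono y∈X (ℕ.n≤1+n i) i+2≤n ℕ.≤-refl ℕ.≤-refl) ,
      lift (coord 0 (suc i) z<s (ℕ.<⇒≤ i+2≤n)) (coord 0 (suc (suc i)) z<s i+2≤n)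
           (λ y∈X → X-mono y∈X ℕ.≤-refl z<s (ℕ.n≤1+n (suc i)) i+2≤n) ,
      lift (coord i (suc (suc i)) (ℕ.m<n⇒m<1+n (ℕ.n<1+n i)) i+2≤n)
           (coord i (suc i) (ℕ.n<1+n i) (ℕ.<⇒≤ i+2≤n) ⊕ coord (suc i) (suc (suc i)) (ℕ.n<1+n (suc i)) i+2≤n)
           (λ y∈X → X-triangle y∈X i+2≤n)) ,
    unshift-supermodular {x = x} supermodular
    where
    open XProperties

    lift : (s t : AffineTerm n) → (∀ {y} → X n y → ⟦ s ⟧ y ≤ ⟦ t ⟧ y) → ⟦ s ⟧ x ≤ ⟦ t ⟧ x
    lift = conv-preserves-≤ x∈Ξ

    0<n : 0 ℕ.< n
    0<n = ℕ.<-≤-trans z<s n≥2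

    supermodular : Supermodular n x
    supermodular {j} {k} j+2≤k k<n =
      lift (coord j (suc k) (ℕ.m<n⇒m<1+n j<k) k<n ⊕ coord (suc j) k j+2≤k (ℕ.<⇒≤ k<n))
           (coord (suc j) (suc k) (ℕ.m<n⇒m<1+n j+2≤k) k<n ⊕ coord j k j<k (ℕ.<⇒≤ k<n))
           (λ y∈X → X-supermodular y∈X j+2≤k k<n)
      where
      j<k : j ℕ.< k
      j<k = ℕ.<-trans (ℕ.n<1+n j) j+2≤k

  module ΘPathProperties {n : ℕ} {x : Coords} (θ : ΘPath n x) where

    ΘPath-≤1 : x 0 n ≤ 1ℚ
    ΘPath-≤1 = proj₁ θ

    ΘPath-shrinkˡ-end : ∀ {i} → suc (suc i) ℕ.≤ n → x (suc i) n ≤ x i n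
    ΘPath-shrinkˡ-end {i} i+2≤n = proj₁ (proj₁ (proj₂ θ) i i+2≤n)

    ΘPath-shrinkʳ-start : ∀ {i} → suc (suc i) ℕ.≤ n → x 0 (suc i) ≤ x 0 (suc (suc i))
    ΘPath-shrinkʳ-start {i} i+2≤n = proj₁ (proj₂ (proj₁ (proj₂ θ) i i+2≤n))

    ΘPath-triangle : ∀ {i} → suc (suc i) ℕ.≤ n → x i (suc (suc i)) ≤ x i (suc i) + x (suc i) (suc (suc i))
    ΘPath-triangle {i} i+2≤n = proj₂ (proj₂ (proj₁ (proj₂ θ) i i+2≤n))

    ΘPath-supermodular : Supermodular n x
    ΘPath-supermodular {i} {k} i+2≤k k<n =
      proj₂ (proj₂ θ) i (suc k) (ℕ.≤-trans (ℕ.≤-reflexive (ℕ.+-comm i 3)) (s≤s i+2≤k)) k<n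

    rowGap : ℕ → ℕ → ℚ
    rowGap i j = x i j - x (suc i) j

    colGap : ℕ → ℕ → ℚ
    colGap k i = x i (suc k) - x i k

    rowGap-antitone : ∀ {i j j′} → suc (suc i) ℕ.≤ j → j ℕ.≤ j′ → j′ ℕ.≤ n → rowGap i j′ ≤ rowGap i j
    rowGap-antitone {i} = ℚ-stepwise⇒antitone (rowGap i)
      (λ {k} i+2≤k k<n → p+q≤r+s⇒p-r≤s-q (x i (suc k)) (x (suc i) k) (x (suc i) (suc k)) (x i k)
                           (ΘPath-supermodular i+2≤k k<n))

    colGap-monotone : ∀ {i i′ m} → i ℕ.≤ i′ → i′ ℕ.≤ m → suc m ℕ.< n → colGap (suc m) i ≤ colGap (suc m) i′
    colGap-monotone {m = m} i≤i′ i′≤m m+1<n = ℚ-stepwise⇒monotone (colGap (suc m))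
      (λ {i} _ i<m → p+q≤r+s⇒p-s≤r-q (x i (suc (suc m))) (x (suc i) (suc m))
                                       (x (suc i) (suc (suc m))) (x i (suc m))
                                       (ΘPath-supermodular (s≤s i<m) m+1<n))
      z≤n i≤i′ i′≤m

    shrinkˡ : ∀ {i j} → suc (suc i) ℕ.≤ j → j ℕ.≤ n → x (suc i) j ≤ x i j
    shrinkˡ i+2≤j j≤n = 0≤q-p⇒p≤q (ℚ.≤-trans
      (p≤q⇒0≤q-p (ΘPath-shrinkˡ-end (ℕ.≤-trans i+2≤j j≤n)))
      (rowGap-antitone i+2≤j j≤n ℕ.≤-refl))

    splitˡ : ∀ {i j} → suc (suc i) ℕ.≤ j → j ℕ.≤ n → x i j ≤ x i (suc i) + x (suc i) j
    splitˡ {i} {j} i+2≤j j≤n = p-r≤q⇒p≤q+r (x (suc i) j) (ℚ.≤-trans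
      (rowGap-antitone ℕ.≤-refl i+2≤j j≤n)
      (p≤q+r⇒p-r≤q (x i (suc i)) (x (suc i) (suc (suc i))) (ΘPath-triangle (ℕ.≤-trans i+2≤j j≤n))))

    shrinkʳ : ∀ {i m} → i ℕ.≤ m → suc (suc m) ℕ.≤ n → x i (suc m) ≤ x i (suc (suc m))
    shrinkʳ i≤m m+2≤n = 0≤q-p⇒p≤q (ℚ.≤-trans
      (p≤q⇒0≤q-p (ΘPath-shrinkʳ-start m+2≤n))
      (colGap-monotone z≤n i≤m m+2≤n))

    splitʳ : ∀ {i m} → i ℕ.≤ m → suc (suc m) ℕ.≤ n → x i (suc (suc m)) ≤ x (suc m) (suc (suc m)) + x i (suc m)
    splitʳ {i} {m} i≤m m+2≤n = p-r≤q⇒p≤q+r (x i (suc m)) (ℚ.≤-trans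
      (colGap-monotone i≤m ℕ.≤-refl m+2≤n)
      (p≤q+r⇒p-r≤q (x (suc m) (suc (suc m))) (x m (suc m))
        (ℚ.≤-trans (ΘPath-triangle m+2≤n) (ℚ.≤-reflexive (ℚ.+-comm (x m (suc m)) (x (suc m) (suc (suc m))))))))

    edge-nonneg : 2 ℕ.≤ n → ∀ {k} → k ℕ.< n → 0ℚ ≤ x k (suc k)
    edge-nonneg n≥2 {zero} _ =
      p≤q+r⇒r≤p⇒0≤q (x 0 1) (x 1 2) (splitˡ ℕ.≤-refl n≥2) (shrinkˡ ℕ.≤-refl n≥2)
    edge-nonneg _ {suc k} k+1<n =
      p≤q+r⇒r≤p⇒0≤q (x (suc k) (suc (suc k))) (x k (suc k)) (splitʳ ℕ.≤-refl k+1<n) (shrinkʳ ℕ.≤-refl k+1<n)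

    row-monotone : ∀ {i j j′} → i ℕ.< j → j ℕ.≤ j′ → j′ ℕ.≤ n → x i j ≤ x i j′
    row-monotone {i} = ℚ-stepwise⇒monotone (x i) step
      where
      step : StepwiseOn _≤_ (x i) (suc i) n
      step (s≤s i≤m) m+1<n = shrinkʳ i≤m m+1<n

    lastColumn≤corner : ∀ {i} → i ℕ.< n → x i n ≤ x 0 n
    lastColumn≤corner {zero}  _     = ℚ.≤-refl
    lastColumn≤corner {suc i} i+1<n =
      ℚ.≤-trans (ΘPath-shrinkˡ-end i+1<n) (lastColumn≤corner (ℕ.<-trans (ℕ.n<1+n i) i+1<n))

    bounds : 2 ℕ.≤ n → ∀ {i j} → i ℕ.< j → j ℕ.≤ n → (0ℚ ≤ x i j) × (x i j ≤ 1ℚ)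
    bounds n≥2 {i} {j} i<j j≤n =
      ℚ.≤-trans (edge-nonneg n≥2 i<n) (row-monotone ℕ.≤-refl i<j j≤n) ,
      ℚ.≤-trans (row-monotone i<j j≤n ℕ.≤-refl) (ℚ.≤-trans (lastColumn≤corner i<n) ΘPath-≤1)
      where
      i<n : i ℕ.< n
      i<n = ℕ.<-≤-trans i<j j≤n

  ΘPath⊆Θ1 : ∀ {n x} → 2 ℕ.≤ n → ΘPath n x → Θ1 n x
  ΘPath⊆Θ1 {n} {x} n≥2 θ = (λ _ _ → bounds n≥2) , pair-constraints
    where
    open ΘPathProperties {n} {x} θ

    pair-constraints : ∀ i j → suc (suc i) ℕ.≤ j → j ℕ.≤ n →
            (x i j ≤ x i (suc i) + x (suc i) j) × (x (suc i) j ≤ x i j) ×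
            (x i j ≤ x (j ℕ.∸ 1) j + x i (j ℕ.∸ 1)) × (x i (j ℕ.∸ 1) ≤ x i j)
    pair-constraints i _ i+2≤j@(s≤s (s≤s i≤m)) j≤n =
      splitˡ i+2≤j j≤n , shrinkˡ i+2≤j j≤n , splitʳ i≤m j≤n , shrinkʳ i≤m j≤n

open PathPolytopes using (Ξ⊆ΘPath; ΘPath⊆Θ1)
open import Data.Nat using (ℕ; _≤_)
open import Data.Product using (_×_; _,_)

lemma10 : (n : ℕ) → 2 ≤ n →
    (∀ x → Ξ n x → ΘPath n x) × (∀ x → ΘPath n x → Θ1 n x)
lemma10 n n≥2 = (λ _ → Ξ⊆ΘPath n≥2) , (λ _ → ΘPath⊆Θ1 n≥2)
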